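{- Let $\mathcal{I}$ be an interpreted system consistent with simple robot exploration, with exploration space $X$, arising from a luminous ($\mathcal{LUMI}$) robot system with full visibility and exploration flooding. Let $U$ be open, $\rho$ a run of $\mathcal{I}$ and $r\in\Pi$. If $\mathcal{I},\rho\models\Diamond K_r\,\mathrm{sp}(U)$, then $\mathcal{I},\rho\models\Diamond E_\Pi\,\mathrm{sp}(U)$.
   Context: $\Pi$ is a finite set of robots. An interpreted system $\mathcal{I}$ is a set of runs; each run $\rho$ is a sequence of global configurations indexed by discrete global time $[t]\in\mathbb{N}$; a point is a pair $(\rho,[t])$. Each configuration assigns each robot $r$ an epistemic (memory) state; $(\rho,[t])\sim_r(\rho',[t'])$ iff $r$ has the same epistemic state at both points, and $\sim_{D_A}=\bigcap_{r\in A}\sim_r$. The exploration space is $X\subseteq[0,1]^k$ with the Euclidean topology; to each open $U$ corresponds an atom $\mathrm{sp}(U)$ ("$U$ has been explored"), with $\mathrm{sp}(V)\to\mathrm{sp}(U)$ whenever $U\subseteq V$. Semantics: $K_r\varphi$ holds at a point iff $\varphi$ holds at all $\sim_r$-related points; $D_A\varphi$ likewise with $\sim_{D_A}$; $\Diamond\varphi$ holds at $(\rho,[t])$ iff $\varphi$ holds at $(\rho,[t'])$ for some $[t']\ge[t]$; $\Box\varphi:=\neg\Diamond\neg\varphi$; $E_\Pi\varphi:=\bigwedge_{r\in\Pi}K_r\varphi$. $\mathcal{I},\rho\models\Diamond\varphi$ means $\varphi$ holds at some point of $\rho$. Consistency with simple robot exploration: for all $r$, open $U$: $\mathcal{I}\models\mathrm{sp}(U)\to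 D_\Pi\mathrm{sp}(U)$; whenever $D_A\mathrm{sp}(U)$ holds at a point there are open $V_r$ ($r\in A$) with $\bigcup V_r=U$ and $K_r\mathrm{sp}(V_r)$ there; $\mathcal{I}\models\mathrm{sp}(U)\to\Box\mathrm{sp}(U)$; $\mathcal{I}\models K_r\mathrm{sp}(U)\to\Box K_r\mathrm{sp}(U)$. In the $\mathcal{LUMI}$ model robots repeatedly execute look–compute–move cycles and carry externally visible lights encoding part of their memory, which other robots observe during their look steps; there are no crash failures (each robot keeps being activated); full visibility means each look observes every robot and its lights. The system is exploration flooding if at each phase of the cycle each robot communicates through its lights the largest region of space it knows to be explored, so that a robot reading these lights comes to know that region is explored. -}

module Defs where

open import Data.Nat using (ℕ; suc; _≤_)
open import Data.Fin using (Fin)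
open import Data.Fin.Subset using (Subset; _∈_; ⊤)
open import Data.Product using (Σ; ∃; _×_; _,_)
open import Relation.Binary.PropositionalEquality using (_≡_)

-- X ⊆ [0,1]^k with the Euclidean topology cannot be
-- built in agda-stdlib (no reals); we abstract it as a type of points
-- together with a type of (names of) open sets and their membership.

record Space : Set₁ where
  field
    Point : Set
    Open  : Set
    _∈ₒ_  : Point → Open → Set

  _⊆ₒ_ : Open → Open → Set
  U ⊆ₒ V = ∀ x → x ∈ₒ U → x ∈ₒ V

record InterpretedSystem (n : ℕ) (X : Space) : Set₁ where
  open Space X
  field
    Run   : Set
    State : Set
    state : Run → ℕ → Fin n → State
    -- valuation of the atoms sp(U) ("U has been explored")
    sp    : Open → Run → ℕ → Set

-- formulas interpreted as predicates on points
Pred : ∀ {n X} → InterpretedSystem n X → Set₁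
Pred I = InterpretedSystem.Run I → ℕ → Set

module Logic {n : ℕ} {X : Space} (I : InterpretedSystem n X) where
  open Space X
  open InterpretedSystem I

  _∼[_]_ : (Run × ℕ) → Fin n → (Run × ℕ) → Set
  (ρ , t) ∼[ r ] (ρ' , t') = state ρ t r ≡ state ρ' t' r

  K : Fin n → Pred I → Pred I
  K r φ ρ t = ∀ ρ' t' → (ρ , t) ∼[ r ] (ρ' , t') → φ ρ' t'

  D : Subset n → Pred I → Pred I
  D A φ ρ t = ∀ ρ' t' → (∀ r → r ∈ A → (ρ , t) ∼[ r ] (ρ' , t')) → φ ρ' t'

  E : Pred I → Pred I
  E φ ρ t = ∀ r → K r φ ρ t

  ◇ : Pred I → Pred I
  ◇ φ ρ t = Σ ℕ λ t' → t ≤ t' × φ ρ t'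

  □ : Pred I → Pred I
  □ φ ρ t = ∀ t' → t ≤ t' → φ ρ t'

  Valid : Pred I → Set
  Valid φ = ∀ ρ t → φ ρ t

  -- I , ρ ⊨ φ  for run-formulas: φ holds at the initial point of ρ
  -- (so I , ρ ⊨ ◇ φ  iff  φ holds at some point of ρ)
  _⊨ᵣ_ : Run → Pred I → Set
  ρ ⊨ᵣ φ = φ ρ 0

  _⇒_ : Pred I → Pred I → Pred I
  (φ ⇒ ψ) ρ t = φ ρ t → ψ ρ t

record SimpleRobotExploration {n : ℕ} {X : Space} (I : InterpretedSystem n X) : Set where
  open Space X
  open InterpretedSystem I
  open Logic I
  field
    sp-mono    : ∀ U V → U ⊆ₒ V → Valid (sp V ⇒ sp U)
    sp-dist    : ∀ U → Valid (sp U ⇒ D ⊤ (sp U))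
    dist-split : ∀ (A : Subset n) U ρ t → D A (sp U) ρ t →
                 Σ (Fin n → Open) λ V →
                   (∀ x → x ∈ₒ U → Σ (Fin n) λ r → r ∈ A × x ∈ₒ V r)
                 × (∀ r → r ∈ A → V r ⊆ₒ U)
                 × (∀ r → r ∈ A → K r (sp (V r)) ρ t)
    sp-persist : ∀ U → Valid (sp U ⇒ □ (sp U))
    K-persist  : ∀ r U → Valid (K r (sp U) ⇒ □ (K r (sp U)))

-- The system arises from a LUMI robot system (look–compute–move cycles,
-- externally visible lights) with exploration flooding.

record LumiSystem {n : ℕ} {X : Space} (I : InterpretedSystem n X) : Set₁ where
  open Space X
  open InterpretedSystem I
  field
    Light    : Set
    light    : Run → ℕ → Fin n → Light
    looks    : Run → ℕ → Fin n → Set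
    -- during its look at (ρ , t), robot r observes robot r' and its lights
    observes : Run → ℕ → Fin n → Fin n → Set
    -- the region of space encoded (communicated) by a light
    region   : Light → Open

module LumiProps {n : ℕ} {X : Space} {I : InterpretedSystem n X}
                 (L : LumiSystem I) where
  open Space X
  open InterpretedSystem I
  open LumiSystem L
  open Logic I

  FullVisibility : Set
  FullVisibility = ∀ ρ t r r' → looks ρ t r → observes ρ t r r'

  NoCrash : Set
  NoCrash = ∀ ρ t r → Σ ℕ λ t' → t ≤ t' × looks ρ t' r

  ExplorationFlooding : Set
  ExplorationFlooding =
      (∀ ρ t r → K r (sp (region (light ρ t r))) ρ t)
    × (∀ ρ t r U → K r (sp U) ρ t → U ⊆ₒ region (light ρ t r))
    × (∀ ρ t r r' → looks ρ t r → observes ρ t r r' →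
         K r (sp (region (light ρ t r'))) ρ (suc t))

{-# OPTIONS --safe #-}
-- A robot that knows U is explored keeps knowing it, so by maximality its
-- light always displays a region containing U.  Every robot looks again
-- after any given time and, under full visibility, reads that light and
-- learns that U is explored; knowledge persists, so once the last of the
-- finitely many robots has looked, everybody knows sp(U).
module Submission where

open import Defs
open import Data.Nat using (ℕ; suc; _≤_; z≤n)
open import Data.Nat.Properties using (m≤n⇒m≤1+n)
open import Data.Fin using (Fin)
open import Data.List using (List; tabulate)
open import Data.List.Extrema.Nat using (max; ⊥≤max; xs≤max)
open import Data.List.Relation.Unary.All.Properties using (tabulate⁻)
open import Data.Product using (_,_; proj₁; proj₂)
open import Function using (_∘_)

module _ {n : ℕ} {X : Space} {I : InterpretedSystem n X} where
  open InterpretedSystem I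
  open Logic I

  K-mono : ∀ {φ ψ : Pred I} r {ρ t} →
           (∀ ρ' t' → φ ρ' t' → ψ ρ' t') → K r φ ρ t → K r ψ ρ t
  K-mono r φ⇒ψ Kφ ρ' t' ∼ = φ⇒ψ ρ' t' (Kφ ρ' t' ∼)

  ◇⇒⊨ᵣ◇ : ∀ {φ : Pred I} {ρ t} → ◇ φ ρ t → ρ ⊨ᵣ ◇ φ
  ◇⇒⊨ᵣ◇ (t' , _ , φt') = t' , z≤n , φt'

  ◇□-all : ∀ {m} (φ : Fin m → Pred I) ρ t →
           (∀ i → ◇ (□ (φ i)) ρ t) → ◇ (λ ρ' t' → ∀ i → φ i ρ' t') ρ t
  ◇□-all φ ρ t ◇□φ = T , ⊥≤max t times , λ i → proj₂ (proj₂ (◇□φ i)) T (tᵢ≤T i)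
    where
      times : List ℕ
      times = tabulate (proj₁ ∘ ◇□φ)
      T : ℕ
      T = max t times
      tᵢ≤T : ∀ i → proj₁ (◇□φ i) ≤ T
      tᵢ≤T = tabulate⁻ (xs≤max t times)

  module _ (S : SimpleRobotExploration I) where
    open SimpleRobotExploration S

    ◇K⇒◇□K : ∀ r U {ρ t} → ◇ (K r (sp U)) ρ t → ◇ (□ (K r (sp U))) ρ t
    ◇K⇒◇□K r U {ρ} (t' , t≤t' , Kt') = t' , t≤t' , K-persist r U ρ t' Kt'

    module _ (L : LumiSystem I)
             (full-visibility : LumiProps.FullVisibility L)
             (no-crash : LumiProps.NoCrash L)
             (flooding : LumiProps.ExplorationFlooding L) where
      open LumiSystem L

      looking-learns-known : ∀ U ρ t r r' → looks ρ t r' →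
                             K r (sp U) ρ t → K r' (sp U) ρ (suc t)
      looking-learns-known U ρ t r r' looking Kr =
        K-mono r' (sp-mono U (region (light ρ t r)) U⊆shown) reads-shown
        where
          U⊆shown : Space._⊆ₒ_ X U (region (light ρ t r))
          U⊆shown = proj₁ (proj₂ flooding) ρ t r U Kr
          reads-shown : K r' (sp (region (light ρ t r))) ρ (suc t)
          reads-shown = proj₂ (proj₂ flooding) ρ t r' r looking
                          (full-visibility ρ t r' r looking)

      knowledge-spreads : ∀ U ρ t r r' → K r (sp U) ρ t → ◇ (K r' (sp U)) ρ t
      knowledge-spreads U ρ t r r' Kr with no-crash ρ t r'
      ... | t' , t≤t' , looking =
        suc t' , m≤n⇒m≤1+n t≤t' ,
        looking-learns-known U ρ t' r r' looking (K-persist r U ρ t Kr t' t≤t')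

      everybody-learns-known : ∀ U ρ t r → K r (sp U) ρ t → ◇ (E (sp U)) ρ t
      everybody-learns-known U ρ t r Kr =
        ◇□-all (λ r' → K r' (sp U)) ρ t λ r' →
          ◇K⇒◇□K r' U (knowledge-spreads U ρ t r r' Kr)

mainTheorem4 : ∀ {n : ℕ} {X : Space} (I : InterpretedSystem n X)
                 → SimpleRobotExploration I
                 → (L : LumiSystem I)
                 → LumiProps.FullVisibility L
                 → LumiProps.NoCrash L
                 → LumiProps.ExplorationFlooding L
                 → (U : Space.Open X) (ρ : InterpretedSystem.Run I) (r : Fin n)
                 → Logic._⊨ᵣ_ I ρ (Logic.◇ I (Logic.K I r (InterpretedSystem.sp I U)))
                 → Logic._⊨ᵣ_ I ρ (Logic.◇ I (Logic.E I (InterpretedSystem.sp I U)))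
mainTheorem4 I S L full-visibility no-crash flooding U ρ r (t , _ , Kr) =
  ◇⇒⊨ᵣ◇ {I = I} {φ = Logic.E I (InterpretedSystem.sp I U)}
    (everybody-learns-known S L full-visibility no-crash flooding U ρ t r Kr)
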